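{- For every integer $n\ge 5$, $m(K(n,2))=3$.
   Context: The Kneser graph $K(n,2)$ has as vertices all $2$-element subsets of $[n]=\{1,\dots,n\}$, two vertices being adjacent iff they are disjoint. For a graph $G$ and $u,v\in V(G)$, the monophonic interval $J_G(u,v)$ is the set of all vertices lying on some induced $u,v$-path in $G$. A set $S\subseteq V(G)$ is a monophonic set of $G$ if for every $w\in V(G)$ there exist $x,y\in S$ with $w\in J_G(x,y)$. The monophonic number $m(G)$ is the minimum cardinality of a monophonic set of $G$. -}

module Defs where

open import Level using (0ℓ)
open import Data.Nat using (ℕ; zero; suc; _<_; _≤_)
open import Data.Fin using (Fin; toℕ; fromℕ)
import Data.Fin
open import Data.Product using (Σ; _×_; _,_; ∃; ∃-syntax)
open import Data.List using (List; length)
open import Data.List.Membership.Propositional using (_∈_)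
open import Data.List.Relation.Unary.Unique.Propositional using (Unique)
open import Relation.Binary.PropositionalEquality using (_≡_; _≢_)
open import Relation.Nullary using (¬_)
open import Function.Definitions using (Injective)

record Graph : Set₁ where
  field
    V   : Set
    Adj : V → V → Set

open Graph public

record InducedPath (G : Graph) (u v : V G) : Set where
  field
    k        : ℕ
    p        : Fin (suc k) → V G
    start    : p Data.Fin.zero ≡ u
    end      : p (fromℕ k) ≡ v
    distinct : Injective _≡_ _≡_ p
    edges    : ∀ i j → toℕ j ≡ suc (toℕ i) → Adj G (p i) (p j)
    chordless : ∀ i j → suc (toℕ i) < toℕ j → ¬ Adj G (p i) (p j)

InMonoInterval : (G : Graph) → V G → V G → V G → Set
InMonoInterval G u v w =
  Σ (InducedPath G u v) λ P → ∃[ i ] InducedPath.p P i ≡ w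

-- S is a monophonic set (finite sets of vertices are duplicate-free lists).
IsMonophonicSet : (G : Graph) → List (V G) → Set
IsMonophonicSet G S =
  ∀ w → ∃[ x ] ∃[ y ] (x ∈ S × y ∈ S × InMonoInterval G x y w)

MonophonicNumber≡ : (G : Graph) → ℕ → Set
MonophonicNumber≡ G k =
  (∃[ S ] (Unique S × length S ≡ k × IsMonophonicSet G S))
  × (∀ S → Unique S → IsMonophonicSet G S → k ≤ length S)

-- Kneser graph K(n,2): vertices {i,j} ⊆ [n] encoded as pairs i < j,
-- adjacent iff the two 2-sets are disjoint.
KVertex : ℕ → Set
KVertex n = Σ (Fin n × Fin n) λ { (i , j) → toℕ i < toℕ j }

Disjoint2 : ∀ {n} → KVertex n → KVertex n → Set
Disjoint2 ((a , b) , _) ((c , d) , _) = a ≢ c × a ≢ d × b ≢ c × b ≢ d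

Kneser2 : ℕ → Graph
Kneser2 n = record { V = KVertex n ; Adj = Disjoint2 }

module Submission where

-- Upper bound: the triangle {01, 02, 12} is monophonic. A 2-set avoiding {0, 1, 2} is the middle
-- of the induced path 01 – w – 02, and a 2-set {e, j} with e ≤ 2 < j lies on an induced path of
-- length 3 between two triangle vertices.
-- Lower bound: a single vertex covers only itself and an adjacent pair only itself, since an
-- induced path between adjacent vertices is the edge. For a nonadjacent pair x = {a, b},
-- y = {a, c}, the vertex z = {b, c} lies on no induced x,y-path: every vertex two steps before
-- the end meets y and every vertex two steps after the start meets x, so both neighbours of z
-- contain a, the vertices two steps away are {c, h} and {b, h} for a common h, and then both
-- neighbours of z equal {a, h}, contradicting that the path is injective.

open import Defs
open import Data.Nat using (ℕ; zero; suc; _+_; _⊓_; _≤_; _<_; _<?_; _≟_; z≤n; s≤s)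
open import Data.Nat.Properties
open import Data.Fin using (Fin; zero; suc; toℕ; fromℕ; fromℕ<; #_)
open import Data.Fin.Properties using (toℕ-injective; toℕ-fromℕ; toℕ-fromℕ<; toℕ≤pred[n])
import Data.Fin.Properties as Fin
open import Data.Product using (_×_; _,_; ∃-syntax; proj₁)
open import Data.Product.Properties using (≡-dec)
open import Data.Sum using (_⊎_; inj₁; inj₂)
open import Data.Empty using (⊥; ⊥-elim)
open import Data.List using (List; []; _∷_; length)
open import Data.List.Relation.Unary.Any using (here; there)
open import Data.List.Relation.Unary.All using ([]; _∷_)
open import Data.List.Relation.Unary.AllPairs using ([]; _∷_)
open import Data.List.Relation.Unary.Unique.Propositional using (Unique)
open import Function using (_∘_)
open import Relation.Binary.Definitions using (tri<; tri≈; tri>; Symmetric; DecidableEquality)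
open import Relation.Binary.PropositionalEquality
open import Relation.Nullary using (¬_; Dec; yes; no)
open import Relation.Nullary.Decidable using (True; False; toWitness; toWitnessFalse; ¬?; _×-dec_; map′; ¬¬-excluded-middle)

-- An induced path indexed by ℕ instead of Fin (suc k); positions beyond k are irrelevant.
record IsInducedSeq (G : Graph) (k : ℕ) (q : ℕ → V G) : Set where
  field
    adjacent  : ∀ {i} → i < k → Adj G (q i) (q (suc i))
    chordless : ∀ {i j} → suc i < j → j ≤ k → ¬ Adj G (q i) (q j)
    injective : ∀ {i j} → i < j → j ≤ k → q i ≢ q j

module _ {G : Graph} where

  inducedPath : ∀ {k q} → IsInducedSeq G k q → InducedPath G (q 0) (q k)
  inducedPath {k} {q} seq = record
    { k = k ; p = q ∘ toℕ ; start = refl ; end = cong q (toℕ-fromℕ k)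
    ; distinct = distinct ; edges = edges ; chordless = chordless′ }
    where
    open IsInducedSeq seq
    distinct : ∀ {i j : Fin (suc k)} → q (toℕ i) ≡ q (toℕ j) → i ≡ j
    distinct {i} {j} eq with <-cmp (toℕ i) (toℕ j)
    ... | tri< i<j _ _ = ⊥-elim (injective i<j (toℕ≤pred[n] j) eq)
    ... | tri≈ _ i≡j _ = toℕ-injective i≡j
    ... | tri> _ _ j<i = ⊥-elim (injective j<i (toℕ≤pred[n] i) (sym eq))
    edges : ∀ i j → toℕ j ≡ suc (toℕ i) → Adj G (q (toℕ i)) (q (toℕ j))
    edges i j j≡1+i = subst (λ m → Adj G (q (toℕ i)) (q m)) (sym j≡1+i)
                        (adjacent (subst (_≤ k) j≡1+i (toℕ≤pred[n] j)))
    chordless′ : ∀ i j → suc (toℕ i) < toℕ j → ¬ Adj G (q (toℕ i)) (q (toℕ j))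
    chordless′ i j i+1<j = chordless i+1<j (toℕ≤pred[n] j)

  ∈-interval : ∀ {k q t} → IsInducedSeq G k q → t ≤ k → InMonoInterval G (q 0) (q k) (q t)
  ∈-interval {q = q} seq t≤k =
    inducedPath seq , fromℕ< (s≤s t≤k) , cong q (toℕ-fromℕ< (s≤s t≤k))

  module Indexed {u v : V G} (P : InducedPath G u v) where
    open InducedPath P

    -- Positions beyond the end of the path are clamped to its last vertex.
    index : ℕ → Fin (suc k)
    index i = fromℕ< (s≤s (m⊓n≤n i k))

    toℕ-index : ∀ {i} → i ≤ k → toℕ (index i) ≡ i
    toℕ-index {i} i≤k = trans (toℕ-fromℕ< (s≤s (m⊓n≤n i k))) (m≤n⇒m⊓n≡m i≤k)

    q : ℕ → V G
    q i = p (index i)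

    q-length : q k ≡ v
    q-length = trans (cong p (toℕ-injective (trans (toℕ-index ≤-refl) (sym (toℕ-fromℕ k))))) end

    q-toℕ : ∀ i → q (toℕ i) ≡ p i
    q-toℕ i = cong p (toℕ-injective (toℕ-index (toℕ≤pred[n] i)))

    isInducedSeq : IsInducedSeq G k q
    isInducedSeq = record
      { adjacent  = λ {i} i<k → edges (index i) (index (suc i))
                      (trans (toℕ-index i<k) (cong suc (sym (toℕ-index (<⇒≤ i<k)))))
      ; chordless = λ {i} {j} i+1<j j≤k → chordless (index i) (index j)
                      (subst₂ (λ a b → suc a < b) (sym (toℕ-index (i≤k i+1<j j≤k))) (sym (toℕ-index j≤k)) i+1<j)
      ; injective = λ {i} {j} i<j j≤k eq → <-irrefl
                      (trans (sym (toℕ-index (<⇒≤ (<-≤-trans i<j j≤k)))) (trans (cong toℕ (distinct eq)) (toℕ-index j≤k)))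
                      i<j
      }
      where
      i≤k : ∀ {i j} → suc i < j → j ≤ k → i ≤ k
      i≤k i+1<j j≤k = ≤-trans (≤-trans (n≤1+n _) (<⇒≤ i+1<j)) j≤k

  interval-elim : (R : V G → V G → V G → Set) →
                  (∀ {k q t} → IsInducedSeq G k q → t ≤ k → R (q 0) (q k) (q t)) →
                  ∀ {u v w} → InMonoInterval G u v w → R u v w
  interval-elim R onSeq (P , i , pᵢ≡w) =
    transport start q-length (trans (q-toℕ i) pᵢ≡w) (onSeq isInducedSeq (toℕ≤pred[n] i))
    where
    open InducedPath P using (start)
    open Indexed P
    transport : ∀ {u v w u′ v′ w′} → u ≡ u′ → v ≡ v′ → w ≡ w′ → R u v w → R u′ v′ w′
    transport refl refl refl r = r

  interval-refl : ∀ {x} → InMonoInterval G x x x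
  interval-refl {x} = ∈-interval seq z≤n
    where
    seq : IsInducedSeq G 0 (λ _ → x)
    seq = record { adjacent = λ () ; chordless = λ { () z≤n } ; injective = λ { () z≤n } }

  interval-self : ∀ {x w} → InMonoInterval G x x w → w ≡ x
  interval-self w∈J = interval-elim (λ u v w → u ≡ v → w ≡ u) closed w∈J refl
    where
    closed : ∀ {k q t} → IsInducedSeq G k q → t ≤ k → q 0 ≡ q k → q t ≡ q 0
    closed {zero} _ z≤n _ = refl
    closed {suc k} seq _ q₀≡qₖ = ⊥-elim (IsInducedSeq.injective seq (s≤s z≤n) ≤-refl q₀≡qₖ)

  -- An induced path between adjacent vertices is that edge: otherwise the edge is a chord.
  interval-adjacent : ∀ {x y w} → Adj G x y → InMonoInterval G x y w → w ≡ x ⊎ w ≡ y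
  interval-adjacent x~y w∈J = interval-elim (λ u v w → Adj G u v → w ≡ u ⊎ w ≡ v) endpoint w∈J x~y
    where
    endpoint : ∀ {k q t} → IsInducedSeq G k q → t ≤ k → Adj G (q 0) (q k) → q t ≡ q 0 ⊎ q t ≡ q k
    endpoint {t = zero} _ _ _ = inj₁ refl
    endpoint {k} {q} {suc t} seq t<k q₀~qₖ with suc t ≟ k
    ... | yes t≡k = inj₂ (cong q t≡k)
    ... | no  t≢k = ⊥-elim (IsInducedSeq.chordless seq (≤-trans (s≤s (s≤s z≤n)) (≤∧≢⇒< t<k t≢k)) ≤-refl q₀~qₖ)

  module _ (irreflexive : ∀ {x y} → Adj G x y → x ≢ y) where

    P₃-interval : ∀ {x w y} → Adj G x w → Adj G w y → ¬ Adj G x y → x ≢ y → InMonoInterval G x y w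
    P₃-interval {x} {w} {y} x~w w~y x≁y x≢y = ∈-interval seq (s≤s z≤n)
      where
      q : ℕ → V G
      q 0 = x
      q 1 = w
      q _ = y
      seq : IsInducedSeq G 2 q
      seq = record { adjacent = adjacent ; chordless = chordless ; injective = injective }
        where
        adjacent : ∀ {i} → i < 2 → Adj G (q i) (q (suc i))
        adjacent {0} _ = x~w
        adjacent {1} _ = w~y
        adjacent {suc (suc _)} (s≤s (s≤s ()))
        chordless : ∀ {i j} → suc i < j → j ≤ 2 → ¬ Adj G (q i) (q j)
        chordless {_} {0} ()
        chordless {_} {1} (s≤s ())
        chordless {0} {2} _ _ = x≁y
        chordless {suc _} {2} (s≤s (s≤s ()))
        chordless {_} {suc (suc (suc _))} _ (s≤s (s≤s ()))
        injective : ∀ {i j} → i < j → j ≤ 2 → q i ≢ q j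
        injective {_} {0} ()
        injective {0} {1} _ _ = irreflexive x~w
        injective {suc _} {1} (s≤s ())
        injective {0} {2} _ _ = x≢y
        injective {1} {2} _ _ = irreflexive w~y
        injective {suc (suc _)} {2} (s≤s (s≤s ()))
        injective {_} {suc (suc (suc _))} _ (s≤s (s≤s ()))

    P₄-interval : ∀ {x w w′ y} → Adj G x w → Adj G w w′ → Adj G w′ y →
                  ¬ Adj G x w′ → ¬ Adj G w y → ¬ Adj G x y → x ≢ w′ → w ≢ y → x ≢ y →
                  InMonoInterval G x y w
    P₄-interval {x} {w} {w′} {y} x~w w~w′ w′~y x≁w′ w≁y x≁y x≢w′ w≢y x≢y = ∈-interval seq (s≤s z≤n)
      where
      q : ℕ → V G
      q 0 = x
      q 1 = w
      q 2 = w′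
      q _ = y
      seq : IsInducedSeq G 3 q
      seq = record { adjacent = adjacent ; chordless = chordless ; injective = injective }
        where
        adjacent : ∀ {i} → i < 3 → Adj G (q i) (q (suc i))
        adjacent {0} _ = x~w
        adjacent {1} _ = w~w′
        adjacent {2} _ = w′~y
        adjacent {suc (suc (suc _))} (s≤s (s≤s (s≤s ())))
        chordless : ∀ {i j} → suc i < j → j ≤ 3 → ¬ Adj G (q i) (q j)
        chordless {_} {0} ()
        chordless {_} {1} (s≤s ())
        chordless {0} {2} _ _ = x≁w′
        chordless {suc _} {2} (s≤s (s≤s ()))
        chordless {0} {3} _ _ = x≁y
        chordless {1} {3} _ _ = w≁y
        chordless {suc (suc _)} {3} (s≤s (s≤s (s≤s ())))
        chordless {_} {suc (suc (suc (suc _)))} _ (s≤s (s≤s (s≤s ())))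
        injective : ∀ {i j} → i < j → j ≤ 3 → q i ≢ q j
        injective {_} {0} ()
        injective {0} {1} _ _ = irreflexive x~w
        injective {suc _} {1} (s≤s ())
        injective {0} {2} _ _ = x≢w′
        injective {1} {2} _ _ = irreflexive w~w′
        injective {suc (suc _)} {2} (s≤s (s≤s ()))
        injective {0} {3} _ _ = x≢y
        injective {1} {3} _ _ = w≢y
        injective {2} {3} _ _ = irreflexive w′~y
        injective {suc (suc (suc _))} {3} (s≤s (s≤s (s≤s ())))
        injective {_} {suc (suc (suc (suc _)))} _ (s≤s (s≤s (s≤s ())))

module _ (G : Graph) (adj-sym : Symmetric (Adj G)) where

  adjacent-pair-covers-itself : ∀ {x y} → Adj G x y → IsMonophonicSet G (x ∷ y ∷ []) → ∀ w → w ≡ x ⊎ w ≡ y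
  adjacent-pair-covers-itself x~y mono w with mono w
  ... | _ , _ , here refl , here refl , w∈J = inj₁ (interval-self w∈J)
  ... | _ , _ , there (here refl) , there (here refl) , w∈J = inj₂ (interval-self w∈J)
  ... | _ , _ , here refl , there (here refl) , w∈J = interval-adjacent x~y w∈J
  ... | _ , _ , there (here refl) , here refl , w∈J with interval-adjacent (adj-sym x~y) w∈J
  ...   | inj₁ w≡y = inj₂ w≡y
  ...   | inj₂ w≡x = inj₁ w≡x

  monophonic-≥3 : ∀ {u₁ u₂ u₃ : V G} → u₁ ≢ u₂ → u₁ ≢ u₃ → u₂ ≢ u₃ →
                  (∀ {x y} → x ≢ y → ¬ Adj G x y → ¬ IsMonophonicSet G (x ∷ y ∷ [])) →
                  ∀ S → Unique S → IsMonophonicSet G S → 3 ≤ length S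
  monophonic-≥3 {u₁} _ _ _ _ [] _ mono with mono u₁
  ... | _ , _ , () , _
  monophonic-≥3 {u₁} {u₂} u₁≢u₂ _ _ _ (x ∷ []) _ mono = ⊥-elim (u₁≢u₂ (trans (only u₁) (sym (only u₂))))
    where
    only : ∀ w → w ≡ x
    only w with mono w
    ... | _ , _ , here refl , here refl , w∈J = interval-self w∈J
  monophonic-≥3 {u₁} {u₂} {u₃} u₁≢u₂ u₁≢u₃ u₂≢u₃ nonadjacent-fails (x ∷ y ∷ []) ((x≢y ∷ []) ∷ _) mono =
    -- The goal is ⊥, so adjacency need not be decidable.
    ⊥-elim (¬¬-excluded-middle λ
      { (yes x~y) → pigeonhole (adjacent-pair-covers-itself x~y mono)
      ; (no x≁y)  → nonadjacent-fails x≢y x≁y mono })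
    where
    pigeonhole : (∀ w → w ≡ x ⊎ w ≡ y) → ⊥
    pigeonhole cover with cover u₁ | cover u₂ | cover u₃
    ... | inj₁ p | inj₁ q | _     = u₁≢u₂ (trans p (sym q))
    ... | inj₂ p | inj₂ q | _     = u₁≢u₂ (trans p (sym q))
    ... | inj₁ p | _     | inj₁ q = u₁≢u₃ (trans p (sym q))
    ... | inj₂ p | _     | inj₂ q = u₁≢u₃ (trans p (sym q))
    ... | _     | inj₁ p | inj₁ q = u₂≢u₃ (trans p (sym q))
    ... | _     | inj₂ p | inj₂ q = u₂≢u₃ (trans p (sym q))
  monophonic-≥3 _ _ _ _ (_ ∷ _ ∷ _ ∷ _) _ _ = s≤s (s≤s (s≤s z≤n))

module _ {n : ℕ} where

  infix 4 _∈ᵥ_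

  -- An inductive family rather than e ≡ i ⊎ e ≡ j, so that a membership proof determines the vertex.
  data _∈ᵥ_ (e : Fin n) : KVertex n → Set where
    first  : ∀ {j} {e<j : toℕ e < toℕ j} → e ∈ᵥ ((e , j) , e<j)
    second : ∀ {i} {i<e : toℕ i < toℕ e} → e ∈ᵥ ((i , e) , i<e)

  vertex-≡ : ∀ {u v : KVertex n} → proj₁ u ≡ proj₁ v → u ≡ v
  vertex-≡ {(_ , i<j)} {(_ , i<j′)} refl = cong (_ ,_) (≤-irrelevant i<j i<j′)

  _≟ᵥ_ : DecidableEquality (KVertex n)
  u ≟ᵥ v = map′ vertex-≡ (cong proj₁) (≡-dec Fin._≟_ Fin._≟_ (proj₁ u) (proj₁ v))

  disjoint? : (u v : KVertex n) → Dec (Disjoint2 u v)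
  disjoint? ((a , b) , _) ((c , d) , _) =
    ¬? (a Fin.≟ c) ×-dec ¬? (a Fin.≟ d) ×-dec ¬? (b Fin.≟ c) ×-dec ¬? (b Fin.≟ d)

  disjoint-sym : ∀ {u v : KVertex n} → Disjoint2 u v → Disjoint2 v u
  disjoint-sym (a≢c , a≢d , b≢c , b≢d) =
    (λ c≡a → a≢c (sym c≡a)) , (λ c≡b → b≢c (sym c≡b)) , (λ d≡a → a≢d (sym d≡a)) , (λ d≡b → b≢d (sym d≡b))

  disjoint-irrefl : ∀ {u v : KVertex n} → Disjoint2 u v → u ≢ v
  disjoint-irrefl (a≢a , _) refl = a≢a refl

  disjoint-∉ : ∀ {u v : KVertex n} {e} → Disjoint2 u v → e ∈ᵥ u → ¬ e ∈ᵥ v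
  disjoint-∉ (a≢c , _ , _ , _) first first = a≢c refl
  disjoint-∉ (_ , a≢d , _ , _) first second = a≢d refl
  disjoint-∉ (_ , _ , b≢c , _) second first = b≢c refl
  disjoint-∉ (_ , _ , _ , b≢d) second second = b≢d refl

  common-element : ∀ {u v : KVertex n} → ¬ Disjoint2 u v → ∃[ e ] e ∈ᵥ u × e ∈ᵥ v
  common-element {((a , b) , _)} {((c , d) , _)} ¬disjoint
    with a Fin.≟ c | a Fin.≟ d | b Fin.≟ c | b Fin.≟ d
  ... | yes refl | _        | _        | _        = a , first , first
  ... | no _     | yes refl | _        | _        = a , first , second
  ... | no _     | no _     | yes refl | _        = b , second , first
  ... | no _     | no _     | no _     | yes refl = b , second , second
  ... | no a≢c   | no a≢d   | no b≢c   | no b≢d   = ⊥-elim (¬disjoint (a≢c , a≢d , b≢c , b≢d))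

  ∈ᵥ-two : ∀ {u : KVertex n} {e f g} → e ∈ᵥ u → f ∈ᵥ u → e ≢ f → g ∈ᵥ u → g ≡ e ⊎ g ≡ f
  ∈ᵥ-two first first e≢f _ = ⊥-elim (e≢f refl)
  ∈ᵥ-two second second e≢f _ = ⊥-elim (e≢f refl)
  ∈ᵥ-two first second _ first = inj₁ refl
  ∈ᵥ-two first second _ second = inj₂ refl
  ∈ᵥ-two second first _ first = inj₂ refl
  ∈ᵥ-two second first _ second = inj₁ refl

  ∈ᵥ-¬three : ∀ {u : KVertex n} {e f g} → e ∈ᵥ u → f ∈ᵥ u → g ∈ᵥ u → e ≢ f → e ≢ g → f ≢ g → ⊥
  ∈ᵥ-¬three e∈u f∈u g∈u e≢f e≢g f≢g with ∈ᵥ-two e∈u f∈u e≢f g∈u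
  ... | inj₁ g≡e = e≢g (sym g≡e)
  ... | inj₂ g≡f = f≢g (sym g≡f)

  ∈ᵥ-ext : ∀ {u v : KVertex n} {e f} → e ∈ᵥ u → f ∈ᵥ u → e ∈ᵥ v → f ∈ᵥ v → e ≢ f → u ≡ v
  ∈ᵥ-ext first first _ _ e≢f = ⊥-elim (e≢f refl)
  ∈ᵥ-ext second second _ _ e≢f = ⊥-elim (e≢f refl)
  ∈ᵥ-ext _ _ first first e≢f = ⊥-elim (e≢f refl)
  ∈ᵥ-ext _ _ second second e≢f = ⊥-elim (e≢f refl)
  ∈ᵥ-ext first second first second _ = vertex-≡ refl
  ∈ᵥ-ext second first second first _ = vertex-≡ refl
  ∈ᵥ-ext (first {e<j = i<j}) second second (first {e<j = j<i}) _ = ⊥-elim (<-asym i<j j<i)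
  ∈ᵥ-ext (second {i<e = j<i}) first first (second {i<e = i<j}) _ = ⊥-elim (<-asym i<j j<i)

  ∈ᵥ-other : ∀ {u : KVertex n} {e} → e ∈ᵥ u → ∃[ f ] f ∈ᵥ u × e ≢ f
  ∈ᵥ-other (first {j} {i<j}) = j , second , λ i≡j → <-irrefl (cong toℕ i≡j) i<j
  ∈ᵥ-other (second {i} {i<j}) = i , first , λ j≡i → <-irrefl (cong toℕ (sym j≡i)) i<j

  pair : (e f : Fin n) → e ≢ f → ∃[ u ] e ∈ᵥ u × f ∈ᵥ u
  pair e f e≢f with <-cmp (toℕ e) (toℕ f)
  ... | tri< e<f _ _ = ((e , f) , e<f) , first , second
  ... | tri≈ _ e≡f _ = ⊥-elim (e≢f (toℕ-injective e≡f))
  ... | tri> _ _ f<e = ((f , e) , f<e) , second , first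

  meets-other : ∀ {u v : KVertex n} {e f} → ¬ Disjoint2 u v → e ∈ᵥ v → f ∈ᵥ v → e ≢ f → ¬ e ∈ᵥ u → f ∈ᵥ u
  meets-other {u} {v} u≁v e∈v f∈v e≢f e∉u with common-element {u = u} {v = v} u≁v
  ... | g , g∈u , g∈v with ∈ᵥ-two e∈v f∈v e≢f g∈v
  ...   | inj₁ refl = ⊥-elim (e∉u g∈u)
  ...   | inj₂ refl = g∈u

module CornerAvoidance {n k : ℕ} {q : ℕ → KVertex n} (seq : IsInducedSeq (Kneser2 n) k q)
    {a b c : Fin n} (a≢b : a ≢ b) (a≢c : a ≢ c) (b≢c : b ≢ c)
    (a∈x : a ∈ᵥ q 0) (b∈x : b ∈ᵥ q 0) (a∈y : a ∈ᵥ q k) (c∈y : c ∈ᵥ q k) where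
  open IsInducedSeq seq

  weaken : ∀ d {m} → d + m ≤ k → m ≤ k
  weaken d d+m≤k = ≤-trans (m≤n+m _ d) d+m≤k

  meets-y : ∀ {j} → 2 + j ≤ k → ¬ Disjoint2 (q j) (q k)
  meets-y j+2≤k = chordless j+2≤k ≤-refl

  meets-x : ∀ {j} → 2 ≤ j → j ≤ k → ¬ Disjoint2 (q j) (q 0)
  meets-x {j} 2≤j j≤k = chordless 2≤j j≤k ∘ disjoint-sym {u = q j} {v = q 0}

  -- The five vertices q s, …, q (4 + s) around z = q (2 + s) are called u₀, u₁, z, u₃, u₄.
  interior : ∀ s → 4 + s ≤ k → b ∈ᵥ q (2 + s) → c ∈ᵥ q (2 + s) → ⊥
  interior s 4+s≤k b∈z c∈z with common-element {u = q s} {v = q (4 + s)} (chordless (m≤n+m _ 2) 4+s≤k)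
  ... | h , h∈u₀ , h∈u₄ = injective (m≤n+m _ 1) (weaken 1 4+s≤k) (∈ᵥ-ext a∈u₁ h∈u₁ a∈u₃ h∈u₃ a≢h)
    where
    b∉u₁ : ¬ b ∈ᵥ q (1 + s)
    b∉u₁ b∈u₁ = disjoint-∉ (adjacent (weaken 2 4+s≤k)) b∈u₁ b∈z
    c∉u₁ : ¬ c ∈ᵥ q (1 + s)
    c∉u₁ c∈u₁ = disjoint-∉ (adjacent (weaken 2 4+s≤k)) c∈u₁ c∈z
    b∉u₃ : ¬ b ∈ᵥ q (3 + s)
    b∉u₃ = disjoint-∉ (adjacent (weaken 1 4+s≤k)) b∈z
    c∉u₃ : ¬ c ∈ᵥ q (3 + s)
    c∉u₃ = disjoint-∉ (adjacent (weaken 1 4+s≤k)) c∈z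
    a∈u₁ : a ∈ᵥ q (1 + s)
    a∈u₁ = meets-other (meets-y (weaken 1 4+s≤k)) c∈y a∈y (≢-sym a≢c) c∉u₁
    a∈u₃ : a ∈ᵥ q (3 + s)
    a∈u₃ = meets-other (meets-x (s≤s (s≤s z≤n)) (weaken 1 4+s≤k)) b∈x a∈x (≢-sym a≢b) b∉u₃
    a∉u₀ : ¬ a ∈ᵥ q s
    a∉u₀ a∈u₀ = disjoint-∉ (adjacent (weaken 3 4+s≤k)) a∈u₀ a∈u₁
    a∉u₄ : ¬ a ∈ᵥ q (4 + s)
    a∉u₄ = disjoint-∉ (adjacent 4+s≤k) a∈u₃
    c∈u₀ : c ∈ᵥ q s
    c∈u₀ = meets-other (meets-y (weaken 2 4+s≤k)) a∈y c∈y a≢c a∉u₀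
    b∈u₄ : b ∈ᵥ q (4 + s)
    b∈u₄ = meets-other (meets-x (s≤s (s≤s z≤n)) 4+s≤k) a∈x b∈x a≢b a∉u₄
    a≢h : a ≢ h
    a≢h refl = a∉u₀ h∈u₀
    b≢h : b ≢ h
    b≢h refl = injective (m≤n+m _ 1) (weaken 2 4+s≤k) (∈ᵥ-ext h∈u₀ c∈u₀ b∈z c∈z b≢c)
    c≢h : c ≢ h
    c≢h refl = injective (m≤n+m _ 1) 4+s≤k (∈ᵥ-ext b∈z c∈z b∈u₄ h∈u₄ b≢c)
    h∈u₁ : h ∈ᵥ q (1 + s)
    h∈u₁ = meets-other (chordless (m≤n+m _ 1) 4+s≤k) b∈u₄ h∈u₄ b≢h b∉u₁
    h∈u₃ : h ∈ᵥ q (3 + s)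
    h∈u₃ = meets-other (chordless (m≤n+m _ 1) (weaken 1 4+s≤k) ∘ disjoint-sym {u = q (3 + s)} {v = q s}) c∈u₀ h∈u₀ c≢h c∉u₃

  avoids : ∀ {t} → t ≤ k → b ∈ᵥ q t → c ∈ᵥ q t → ⊥
  avoids {zero} _ _ c∈x = ∈ᵥ-¬three a∈x b∈x c∈x a≢b a≢c b≢c
  avoids {suc t} t<k b∈z c∈z with suc t ≟ k
  ... | yes refl = ∈ᵥ-¬three a∈y b∈z c∈y a≢b a≢c b≢c
  avoids {1} 0<k b∈z _ | no _ = disjoint-∉ (adjacent 0<k) b∈x b∈z
  avoids {suc (suc s)} 2+s≤k b∈z c∈z | no 2+s≢k with 3 + s ≟ k
  ... | yes refl = disjoint-∉ (adjacent ≤-refl) c∈z c∈y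
  ... | no 3+s≢k = interior s (≤∧≢⇒< (≤∧≢⇒< 2+s≤k 2+s≢k) 3+s≢k) b∈z c∈z

module _ {n : ℕ} where

  corner-∉-interval : ∀ {x y z : KVertex n} {a b c} → a ≢ b → a ≢ c → b ≢ c →
                      a ∈ᵥ x → b ∈ᵥ x → a ∈ᵥ y → c ∈ᵥ y → b ∈ᵥ z → c ∈ᵥ z →
                      ¬ InMonoInterval (Kneser2 n) x y z
  corner-∉-interval {a = a} {b} {c} a≢b a≢c b≢c a∈x b∈x a∈y c∈y b∈z c∈z z∈J =
    interval-elim (λ x y z → a ∈ᵥ x → b ∈ᵥ x → a ∈ᵥ y → c ∈ᵥ y → b ∈ᵥ z → c ∈ᵥ z → ⊥)
      (λ seq t≤k a∈x b∈x a∈y c∈y → CornerAvoidance.avoids seq a≢b a≢c b≢c a∈x b∈x a∈y c∈y t≤k)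
      z∈J a∈x b∈x a∈y c∈y b∈z c∈z

  nonadjacent-pair-not-monophonic : ∀ {x y : KVertex n} → x ≢ y → ¬ Disjoint2 x y →
                                    ¬ IsMonophonicSet (Kneser2 n) (x ∷ y ∷ [])
  nonadjacent-pair-not-monophonic {x} {y} x≢y x≁y mono
    with common-element {u = x} {v = y} x≁y
  ... | a , a∈x , a∈y with ∈ᵥ-other a∈x | ∈ᵥ-other a∈y
  ... | b , b∈x , a≢b | c , c∈y , a≢c = uncovered (pair b c b≢c)
    where
    b≢c : b ≢ c
    b≢c refl = x≢y (∈ᵥ-ext a∈x b∈x a∈y c∈y a≢b)
    uncovered : (∃[ z ] b ∈ᵥ z × c ∈ᵥ z) → ⊥
    uncovered (z , b∈z , c∈z) with mono z
    ... | _ , _ , here refl , here refl , z∈J =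
      ∈ᵥ-¬three a∈x b∈x (subst (c ∈ᵥ_) (interval-self z∈J) c∈z) a≢b a≢c b≢c
    ... | _ , _ , there (here refl) , there (here refl) , z∈J =
      ∈ᵥ-¬three a∈y (subst (b ∈ᵥ_) (interval-self z∈J) b∈z) c∈y a≢b a≢c b≢c
    ... | _ , _ , here refl , there (here refl) , z∈J =
      corner-∉-interval a≢b a≢c b≢c a∈x b∈x a∈y c∈y b∈z c∈z z∈J
    ... | _ , _ , there (here refl) , here refl , z∈J =
      corner-∉-interval a≢c a≢b (≢-sym b≢c) a∈y c∈y a∈x b∈x c∈z b∈z z∈J

module _ {n : ℕ} where

  vertex : (i j : Fin n) → {True (toℕ i <? toℕ j)} → KVertex n
  vertex i j {i<j} = (i , j) , toWitness i<j

  P₃-in-interval : (x w y : KVertex n) →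
    {True (disjoint? x w)} → {True (disjoint? w y)} → {False (disjoint? x y)} → {False (x ≟ᵥ y)} →
    InMonoInterval (Kneser2 n) x y w
  P₃-in-interval x w y {x~w} {w~y} {x≁y} {x≢y} =
    P₃-interval disjoint-irrefl (toWitness x~w) (toWitness w~y) (toWitnessFalse x≁y) (toWitnessFalse x≢y)

  P₄-in-interval : (x w w′ y : KVertex n) →
    {True (disjoint? x w)} → {True (disjoint? w w′)} → {True (disjoint? w′ y)} →
    {False (disjoint? x w′)} → {False (disjoint? w y)} → {False (disjoint? x y)} →
    {False (x ≟ᵥ w′)} → {False (w ≟ᵥ y)} → {False (x ≟ᵥ y)} →
    InMonoInterval (Kneser2 n) x y w
  P₄-in-interval x w w′ y {x~w} {w~w′} {w′~y} {x≁w′} {w≁y} {x≁y} {x≢w′} {w≢y} {x≢y} =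
    P₄-interval disjoint-irrefl (toWitness x~w) (toWitness w~w′) (toWitness w′~y)
      (toWitnessFalse x≁w′) (toWitnessFalse w≁y) (toWitnessFalse x≁y)
      (toWitnessFalse x≢w′) (toWitnessFalse w≢y) (toWitnessFalse x≢y)

module Triangle (m : ℕ) where

  v₀₁ v₀₂ v₁₂ : KVertex (5 + m)
  v₀₁ = vertex (# 0) (# 1)
  v₀₂ = vertex (# 0) (# 2)
  v₁₂ = vertex (# 1) (# 2)

  triangle : List (KVertex (5 + m))
  triangle = v₀₁ ∷ v₀₂ ∷ v₁₂ ∷ []

  triangle-unique : Unique triangle
  triangle-unique = ((λ ()) ∷ (λ ()) ∷ []) ∷ ((λ ()) ∷ []) ∷ [] ∷ []

  -- The paths of length 3 through {e, j} use a second point j′ ≥ 3 besides j: this is where n ≥ 5 is needed.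
  triangle-monophonic : IsMonophonicSet (Kneser2 (5 + m)) triangle
  triangle-monophonic ((_ , zero) , ())
  triangle-monophonic ((zero , suc zero) , s≤s z≤n) = v₀₁ , v₀₁ , here refl , here refl , interval-refl
  triangle-monophonic ((suc _ , suc zero) , s≤s ())
  triangle-monophonic ((zero , suc (suc zero)) , s≤s z≤n) = v₀₂ , v₀₂ , there (here refl) , there (here refl) , interval-refl
  triangle-monophonic ((suc zero , suc (suc zero)) , s≤s (s≤s z≤n)) =
    v₁₂ , v₁₂ , there (there (here refl)) , there (there (here refl)) , interval-refl
  triangle-monophonic ((suc (suc _) , suc (suc zero)) , s≤s (s≤s ()))
  triangle-monophonic w@((zero , suc (suc (suc zero))) , _) =
    v₁₂ , v₀₁ , there (there (here refl)) , here refl , P₄-in-interval v₁₂ w (vertex (# 2) (# 4)) v₀₁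
  triangle-monophonic w@((suc zero , suc (suc (suc zero))) , _) =
    v₀₂ , v₀₁ , there (here refl) , here refl , P₄-in-interval v₀₂ w (vertex (# 2) (# 4)) v₀₁
  triangle-monophonic w@((suc (suc zero) , suc (suc (suc zero))) , _) =
    v₀₁ , v₀₂ , here refl , there (here refl) , P₄-in-interval v₀₁ w (vertex (# 1) (# 4)) v₀₂
  triangle-monophonic ((suc (suc (suc _)) , suc (suc (suc zero))) , s≤s (s≤s (s≤s ())))
  triangle-monophonic w@((zero , suc (suc (suc (suc _)))) , _) =
    v₁₂ , v₀₁ , there (there (here refl)) , here refl , P₄-in-interval v₁₂ w (vertex (# 2) (# 3)) v₀₁
  triangle-monophonic w@((suc zero , suc (suc (suc (suc _)))) , _) =
    v₀₂ , v₀₁ , there (here refl) , here refl , P₄-in-interval v₀₂ w (vertex (# 2) (# 3)) v₀₁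
  triangle-monophonic w@((suc (suc zero) , suc (suc (suc (suc _)))) , _) =
    v₀₁ , v₀₂ , here refl , there (here refl) , P₄-in-interval v₀₁ w (vertex (# 1) (# 3)) v₀₂
  triangle-monophonic w@((suc (suc (suc _)) , suc (suc (suc (suc _)))) , _) =
    v₀₁ , v₀₂ , here refl , there (here refl) , P₃-in-interval v₀₁ w v₀₂

theorem2p2 : ∀ (n : ℕ) → 5 ≤ n → MonophonicNumber≡ (Kneser2 n) 3
theorem2p2 (suc (suc (suc (suc (suc m))))) (s≤s (s≤s (s≤s (s≤s (s≤s _))))) =
  (triangle , triangle-unique , refl , triangle-monophonic) ,
  monophonic-≥3 (Kneser2 (5 + m)) (λ {u} {v} → disjoint-sym {5 + m} {u} {v}) {v₀₁} {v₀₂} {v₁₂} (λ ()) (λ ()) (λ ())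
    nonadjacent-pair-not-monophonic
  where open Triangle m
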